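{- Let $T$ be a based scheme on $X$, $U$ a based scheme on $Y$, and $S$ a based scheme on $Z$ with basepoint $z_*$. Let $\tilde T\subseteq S$ be a closed subset such that the subscheme of $S$ defined by $z_*\tilde T$ is based-isomorphic to $T$, and let $i:U\to S$ be a based morphism of schemes such that $i\pi:U\to S/\!\!/\tilde T$ is an isomorphism, where $\pi:S\to S/\!\!/\tilde T$ is the natural morphism. Assume $|t(ui)|=1$ for every $u\in U$ and $t\in\tilde T$. Then $\tilde T$ is a normal closed subset of $S$.
   Context: All schemes are association schemes on finite sets. Complex product $pq=\{r\in S:a_{pqr}>0\}$, extended to subsets; closed: $\tilde T^*\tilde T\subseteq\tilde T$; normal: $s\tilde T=\tilde Ts$ for all $s\in S$. For closed $\tilde T$: $z\tilde T=\bigcup_{t\in\tilde T}zt$, $zt=\{z':(z,z')\in t\}$; $s^{\tilde T}=\{(z_1\tilde T,z_2\tilde T):(z_1',z_2')\in s$ for some $z_i'\in z_i\tilde T\}$; $S/\!\!/\tilde T=\{s^{\tilde T}\}$; the subscheme defined by $z\tilde T$ is $\{t\cap(z\tilde T\times z\tilde T):t\in\tilde T\}$. A morphism $i$ from $U$ on $Y$ to $S$ on $Z$ is a map $Y\to Z$ sending pairs in a common element of $U$ to pairs in a common element of $S$; $ui$ denotes the element of $S$ containing the images of pairs of $u$. Isomorphisms are bijective on points and relations; based morphisms preserve basepoints (quotients based at the coset of the basepoint). -}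

module Defs where

open import Data.Nat using (ℕ; zero; suc; _+_)
open import Data.Bool using (Bool; true; false; _∧_; if_then_else_)
open import Data.Fin using (Fin; zero; suc)
open import Data.Fin.Properties using (_≟_)
open import Data.Fin.Subset using (Subset; _∈_)
open import Data.Product using (Σ; _×_; _,_; proj₁; proj₂; ∃-syntax)
open import Relation.Nullary.Decidable using (⌊_⌋)
open import Relation.Binary.PropositionalEquality using (_≡_)

_⇔_ : Set → Set → Set
A ⇔ B = (A → B) × (B → A)

count : ∀ {n} → (Fin n → Bool) → ℕ
count {zero} P = 0
count {suc n} P = (if P zero then 1 else 0) + count (λ i → P (suc i))

-- Relations: Fin d; the
-- relation (element of S) containing the pair (x , y) is  rel x y.
-- So S is a partition of Fin n × Fin n into d nonempty classes.

record Scheme : Set where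
  field
    n d   : ℕ
    rel   : Fin n → Fin n → Fin d
    surj  : ∀ (s : Fin d) → Σ (Fin n) λ x → Σ (Fin n) λ y → rel x y ≡ s
    one   : Fin d
    diag  : ∀ x y → (rel x y ≡ one) ⇔ (x ≡ y)
    -- S is closed under transposition
    trans-closed : ∀ x y x' y' → rel x y ≡ rel x' y' → rel y x ≡ rel y' x'
    -- intersection numbers a_{pqr} are well defined
    regular : ∀ (p q : Fin d) x z x' z' → rel x z ≡ rel x' z' →
      count (λ y → ⌊ rel x y ≟ p ⌋ ∧ ⌊ rel y z ≟ q ⌋)
        ≡ count (λ y → ⌊ rel x' y ≟ p ⌋ ∧ ⌊ rel y z' ≟ q ⌋)
    base  : Fin n

module _ (S : Scheme) where
  open Scheme S

  star : Fin d → Fin d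
  star s with surj s
  ... | x , y , _ = rel y x

  -- intersection number a_{pqr}, computed at a pair (x , z) ∈ r
  -- (well defined by regularity)
  -- complex product: r ∈ p q  iff  a_{pqr} > 0, i.e. there is a pair
  -- (x , z) ∈ r and y with (x , y) ∈ p, (y , z) ∈ q.
  Prod : Fin d → Fin d → Fin d → Set
  Prod p q r = Σ (Fin n) λ x → Σ (Fin n) λ y → Σ (Fin n) λ z →
    (rel x y ≡ p) × (rel y z ≡ q) × (rel x z ≡ r)

  Closed : Subset d → Set
  Closed T = ∀ t₁ t₂ r → t₁ ∈ T → t₂ ∈ T → Prod (star t₁) t₂ r → r ∈ T

  Normal : Subset d → Set
  Normal T = ∀ s r →
    (Σ (Fin d) λ t → t ∈ T × Prod s t r) ⇔ (Σ (Fin d) λ t → t ∈ T × Prod t s r)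

  ProdSingleton : Fin d → Fin d → Set
  ProdSingleton p q = Σ (Fin d) λ r → Prod p q r × (∀ r' → Prod p q r' → r' ≡ r)

-- Relational structures: points up to an equivalence, relations up to an
-- equivalence, and the relation containing a given pair.  Schemes,
-- subschemes and quotient schemes are all presented this way.

record Str : Set₁ where
  field
    Pt  : Set
    _≈_ : Pt → Pt → Set
    Rel : Set
    _≃_ : Rel → Rel → Set
    rel : Pt → Pt → Rel

record IsMorphism (A B : Str) (f : Str.Pt A → Str.Pt B) : Set where
  open Str
  field
    resp   : ∀ x y → _≈_ A x y → _≈_ B (f x) (f y)
    hom    : ∀ x y x' y' → _≃_ A (rel A x y) (rel A x' y')
                         → _≃_ B (rel B (f x) (f y)) (rel B (f x') (f y'))

record IsIso (A B : Str) (f : Str.Pt A → Str.Pt B) : Set where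
  open Str
  field
    morph     : IsMorphism A B f
    pt-inj    : ∀ x y → _≈_ B (f x) (f y) → _≈_ A x y
    pt-surj   : ∀ b → Σ (Pt A) λ a → _≈_ B (f a) b
    rel-inj   : ∀ x y x' y' → _≃_ B (rel B (f x) (f y)) (rel B (f x') (f y'))
                            → _≃_ A (rel A x y) (rel A x' y')
    rel-surj  : ∀ b b' → Σ (Pt A) λ a → Σ (Pt A) λ a' →
                  _≃_ B (rel B (f a) (f a')) (rel B b b')

str : Scheme → Str
str S = record { Pt = Fin n ; _≈_ = _≡_ ; Rel = Fin d ; _≃_ = _≡_ ; rel = rel }
  where open Scheme S

-- Subscheme defined by z_* T: points z with (z_* , z) ∈ t for some t ∈ T;
-- its relations are t ∩ (z_*T × z_*T), t ∈ T, identified with t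
-- (distinct t ∈ T give distinct nonempty restrictions).
subStr : (S : Scheme) → Subset (Scheme.d S) → Str
subStr S T = record
  { Pt  = Σ (Fin n) λ z → rel base z ∈ T
  ; _≈_ = λ a b → proj₁ a ≡ proj₁ b
  ; Rel = Fin d
  ; _≃_ = _≡_
  ; rel = λ a b → rel (proj₁ a) (proj₁ b) }
  where open Scheme S

module _ (S : Scheme) (T : Subset (Scheme.d S)) where
  open Scheme S

  InCoset : Fin n → Fin n → Set
  InCoset z z' = rel z z' ∈ T

  InQ : Fin d → Fin n → Fin n → Set
  InQ s z₁ z₂ = Σ (Fin n) λ z₁' → Σ (Fin n) λ z₂' →
    InCoset z₁ z₁' × InCoset z₂ z₂' × (rel z₁' z₂' ≡ s)

-- Quotient S//T: points are cosets zT (represented by z, with z₁ ≈ z₂ iff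
-- z₁T = z₂T as sets), relations are s^T (represented by s, with s ≃ s'
-- iff s^T = s'^T as sets of pairs of cosets).  The pair (z₁T , z₂T) lies
-- in (rel z₁ z₂)^T.  The natural morphism π : S → S//T is z ↦ zT.
quotStr : (S : Scheme) → Subset (Scheme.d S) → Str
quotStr S T = record
  { Pt  = Fin n
  ; _≈_ = λ z₁ z₂ → ∀ z → InCoset S T z₁ z ⇔ InCoset S T z₂ z
  ; Rel = Fin d
  ; _≃_ = λ s s' → ∀ z₁ z₂ → InQ S T s z₁ z₂ ⇔ InQ S T s' z₁ z₂
  ; rel = rel }
  where open Scheme S

record IsBasedMorphism (U S : Scheme) (i : Fin (Scheme.n U) → Fin (Scheme.n S)) : Set where
  field
    morph : IsMorphism (str U) (str S) i
    based : i (Scheme.base U) ≡ Scheme.base S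

-- u i : the element of S containing the images of the pairs of u.
imgRel : (U S : Scheme) → (Fin (Scheme.n U) → Fin (Scheme.n S)) → Fin (Scheme.d U) → Fin (Scheme.d S)
imgRel U S i u with Scheme.surj U u
... | y , y' , _ = Scheme.rel S (i y) (i y')

-- Closedness makes "z ∈ yT̃" an equivalence relation, so two quotient relations
-- s^T̃ sharing a pair of cosets coincide.  Normality reduces to: for x ∈ yT̃ and
-- any z there is m ∈ zT̃ with (x , m) ∈ rel y z.  Pick y ∈ (i p)T̃, z ∈ (i q)T̃.
-- A rel (i p) (i q)-neighbour of a point c ∈ (i p)T̃ lies in some (i q')T̃;
-- injectivity of iπ on relations gives rel (i p) (i q') = rel (i p) (i q), and
-- then |t (u i)| = 1 with t = rel c (i p) gives rel c (i q') = rel c (i q), so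
-- the neighbour can be moved into (i q)T̃.  Doing this at y and at x, and
-- transporting the path y → z → (i q)T̃ to x by regularity, produces m.
module Submission where

open import Defs
open import Data.Fin using (Fin)
open import Data.Fin.Subset using (Subset; _∈_)
open import Data.Product using (Σ; _×_; proj₁)
open import Relation.Binary.PropositionalEquality using (_≡_)

open import Data.Nat using (zero; suc)
open import Data.Bool using (Bool; true; false; T; _∧_)
open import Data.Bool.Properties using (T-∧)
import Data.Fin as Fin
open import Data.Fin.Properties using (_≟_)
open import Data.Product using (_,_; proj₂)
open import Relation.Nullary using (Dec)
open import Relation.Nullary.Decidable using (⌊_⌋; toWitness; fromWitness)
open import Function.Bundles using (Equivalence)
open import Relation.Binary.PropositionalEquality using (_≢_; refl; sym; trans; subst)

open Equivalence using (to; from)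

count≢0 : ∀ {n} (P : Fin n → Bool) {i} → T (P i) → count P ≢ 0
count≢0 {suc n} P {Fin.zero} Pi with P Fin.zero
... | true = λ ()
count≢0 {suc n} P {Fin.suc i} Pi with P Fin.zero
... | true  = λ ()
... | false = count≢0 (λ j → P (Fin.suc j)) Pi

count-witness : ∀ {n} (P : Fin n → Bool) → count P ≢ 0 → Σ (Fin n) λ i → T (P i)
count-witness {zero} P c≢0 with c≢0 refl
... | ()
count-witness {suc n} P c≢0 with P Fin.zero in eq
... | true  = Fin.zero , subst T (sym eq) _
... | false with count-witness (λ j → P (Fin.suc j)) c≢0
...   | i , Pi = Fin.suc i , Pi

∧-toWitness : ∀ {A B : Set} (a? : Dec A) (b? : Dec B) → T (⌊ a? ⌋ ∧ ⌊ b? ⌋) → A × B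
∧-toWitness a? b? a∧b = toWitness {a? = a?} (proj₁ (to T-∧ a∧b)) , toWitness {a? = b?} (proj₂ (to T-∧ a∧b))

∧-fromWitness : ∀ {A B : Set} (a? : Dec A) (b? : Dec B) → A × B → T (⌊ a? ⌋ ∧ ⌊ b? ⌋)
∧-fromWitness a? b? (a , b) = from T-∧ (fromWitness {a? = a?} a , fromWitness {a? = b?} b)

module SchemeProperties (S : Scheme) where
  open Scheme S

  rel-self : ∀ x y → rel x x ≡ rel y y
  rel-self x y = trans (proj₂ (diag x x) refl) (sym (proj₂ (diag y y) refl))

  star-rel : ∀ {x y s} → rel x y ≡ s → star S s ≡ rel y x
  star-rel {x} {y} {s} e with surj s
  ... | x₀ , y₀ , e₀ = trans-closed x₀ y₀ x y (trans e₀ (sym e))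

  path-transport : ∀ {x z x' z' y} → rel x z ≡ rel x' z' →
    Σ (Fin n) λ y' → rel x' y' ≡ rel x y × rel y' z' ≡ rel y z
  path-transport {x} {z} {x'} {z'} {y} e =
    y' , ∧-toWitness (rel x' y' ≟ rel x y) (rel y' z' ≟ rel y z) (proj₂ witness)
    where
    paths : Fin n → Fin n → Fin n → Bool
    paths a b w = ⌊ rel a w ≟ rel x y ⌋ ∧ ⌊ rel w b ≟ rel y z ⌋
    count'≢0 : count (paths x' z') ≢ 0
    count'≢0 c≡0 =
      count≢0 (paths x z) (∧-fromWitness (rel x y ≟ rel x y) (rel y z ≟ rel y z) (refl , refl))
              (trans (regular (rel x y) (rel y z) x z x' z' e) c≡0)
    witness = count-witness (paths x' z') count'≢0
    y' = proj₁ witness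

  neighbour : ∀ s x → Σ (Fin n) λ y → rel x y ≡ s
  neighbour s x with surj s
  ... | x₀ , y₀ , e with path-transport {x₀} {x₀} {x} {x} {y₀} (rel-self x₀ x)
  ... | y , e' , _ = y , trans e' e

module Cosets (S : Scheme) (T̃ : Subset (Scheme.d S)) (closed : Closed S T̃)
              {x₀ y₀ : Fin (Scheme.n S)} (inhabited : InCoset S T̃ x₀ y₀) where
  open Scheme S
  open SchemeProperties S

  _∈_·T̃ : Fin n → Fin n → Set
  z ∈ y ·T̃ = InCoset S T̃ y z

  coset-euclidean : ∀ {x y z} → x ∈ y ·T̃ → z ∈ y ·T̃ → z ∈ x ·T̃
  coset-euclidean {x} {y} {z} x∈yT̃ z∈yT̃ =
    closed (rel y x) (rel y z) (rel x z) x∈yT̃ z∈yT̃ (x , y , z , sym (star-rel refl) , refl , refl)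

  coset-refl : ∀ x → x ∈ x ·T̃
  coset-refl x = subst (_∈ T̃) (rel-self y₀ x) (coset-euclidean inhabited inhabited)

  coset-sym : ∀ {x y} → y ∈ x ·T̃ → x ∈ y ·T̃
  coset-sym {x} y∈xT̃ = coset-euclidean y∈xT̃ (coset-refl x)

  coset-trans : ∀ {x y z} → y ∈ x ·T̃ → z ∈ y ·T̃ → z ∈ x ·T̃
  coset-trans y∈xT̃ z∈yT̃ = coset-euclidean (coset-sym y∈xT̃) z∈yT̃

  InQ-⊆ : ∀ {s s' z₁ z₂} → InQ S T̃ s z₁ z₂ → InQ S T̃ s' z₁ z₂ →
          ∀ {y₁ y₂} → InQ S T̃ s y₁ y₂ → InQ S T̃ s' y₁ y₂
  InQ-⊆ (a₁ , a₂ , a₁∈ , a₂∈ , a₁a₂≡s) (b₁ , b₂ , b₁∈ , b₂∈ , b₁b₂≡s') (c₁ , c₂ , c₁∈ , c₂∈ , c₁c₂≡s)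
    with path-transport {a₁} {a₂} {c₁} {c₂} {b₁} (trans a₁a₂≡s (sym c₁c₂≡s))
  ... | m , c₁m≡a₁b₁ , ma₂≡b₁a₂ with path-transport {b₁} {a₂} {m} {c₂} {b₂} (sym ma₂≡b₁a₂)
  ... | m' , mm'≡b₁b₂ , m'c₂≡b₂a₂ =
    m , m' ,
    coset-trans c₁∈ (subst (_∈ T̃) (sym c₁m≡a₁b₁) (coset-euclidean a₁∈ b₁∈)) ,
    coset-trans c₂∈ (coset-sym (subst (_∈ T̃) (sym m'c₂≡b₂a₂) (coset-euclidean b₂∈ a₂∈))) ,
    trans mm'≡b₁b₂ b₁b₂≡s'

  InQ-≃ : ∀ {s s' z₁ z₂} → InQ S T̃ s z₁ z₂ → InQ S T̃ s' z₁ z₂ → Str._≃_ (quotStr S T̃) s s'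
  InQ-≃ q q' z₁ z₂ = InQ-⊆ q q' , InQ-⊆ q' q

  CosetLifting : Set
  CosetLifting = ∀ {x y} z → x ∈ y ·T̃ → Σ (Fin n) λ m → rel x m ≡ rel y z × m ∈ z ·T̃

  coset-lifting⇒normal : CosetLifting → Normal S T̃
  coset-lifting⇒normal lift s r = sT̃⊆T̃s , T̃s⊆sT̃
    where
    sT̃⊆T̃s : (Σ (Fin d) λ t → t ∈ T̃ × Prod S s t r) → (Σ (Fin d) λ t → t ∈ T̃ × Prod S t s r)
    sT̃⊆T̃s (t , t∈T̃ , x , y , z , xy≡s , yz≡t , xz≡r)
      with lift x (subst (_∈ T̃) (sym yz≡t) t∈T̃)
    ... | m , zm≡yx , m∈xT̃ =
      rel x m , m∈xT̃ , x , m , z , refl , trans (trans-closed z m y x zm≡yx) xy≡s , xz≡r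
    T̃s⊆sT̃ : (Σ (Fin d) λ t → t ∈ T̃ × Prod S t s r) → (Σ (Fin d) λ t → t ∈ T̃ × Prod S s t r)
    T̃s⊆sT̃ (t , t∈T̃ , x , y , z , xy≡t , yz≡s , xz≡r)
      with lift z (coset-sym (subst (_∈ T̃) (sym xy≡t) t∈T̃))
    ... | m , xm≡yz , m∈zT̃ =
      rel m z , coset-sym m∈zT̃ , x , m , z , trans xm≡yz yz≡s , refl , xz≡r

imgRel-rel : ∀ (U S : Scheme) {i} → IsMorphism (str U) (str S) i →
  ∀ p q → imgRel U S i (Scheme.rel U p q) ≡ Scheme.rel S (i p) (i q)
imgRel-rel U S {i} morph p q with Scheme.surj U (Scheme.rel U p q)
... | y , y' , e = IsMorphism.hom morph y y' p q e

module CosetLiftingFromSection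
  (U S : Scheme) (T̃ : Subset (Scheme.d S)) (closed : Closed S T̃)
  {x₀ y₀ : Fin (Scheme.n S)} (inhabited : InCoset S T̃ x₀ y₀)
  (i : Fin (Scheme.n U) → Fin (Scheme.n S))
  (morph : IsMorphism (str U) (str S) i)
  (iso : IsIso (str U) (quotStr S T̃) i)
  (singleton : ∀ u t → t ∈ T̃ → ProdSingleton S t (imgRel U S i u)) where
  open Scheme S
  open SchemeProperties S
  open Cosets S T̃ closed inhabited
  module U = Scheme U

  representative : ∀ y → Σ (Fin U.n) λ p → y ∈ i p ·T̃
  representative y with IsIso.pt-surj iso y
  ... | p , ip≈y = p , proj₂ (ip≈y y) (coset-refl y)

  rel-injective-modulo-T̃ : ∀ p q q' → InQ S T̃ (rel (i p) (i q)) (i p) (i q') →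
    rel (i p) (i q') ≡ rel (i p) (i q)
  rel-injective-modulo-T̃ p q q' q'-related =
    IsMorphism.hom morph p q' p q (IsIso.rel-inj iso p q' p q
      (InQ-≃ (i p , i q' , coset-refl (i p) , coset-refl (i q') , refl) q'-related))

  rel-from-coset-determined : ∀ p q q' {c} → c ∈ i p ·T̃ →
    rel (i p) (i q') ≡ rel (i p) (i q) → rel c (i q') ≡ rel c (i q)
  rel-from-coset-determined p q q' {c} c∈ipT̃ same =
    trans (unique _ (c , i p , i q' , refl , trans same (sym ui≡) , refl))
          (sym (unique _ (c , i p , i q , refl , sym ui≡ , refl)))
    where
    ui≡ = imgRel-rel U S morph p q
    unique = proj₂ (proj₂ (singleton (U.rel p q) (rel c (i p)) (coset-sym c∈ipT̃)))

  neighbour-in-coset : ∀ p q {c} → c ∈ i p ·T̃ →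
    Σ (Fin n) λ w → rel c w ≡ rel (i p) (i q) × w ∈ i q ·T̃
  neighbour-in-coset p q {c} c∈ipT̃ with neighbour (rel (i p) (i q)) c
  ... | w , cw≡ with representative w
  ... | q' , w∈iq'T̃
    with path-transport {c} {i q'} {c} {i q} {w}
           (rel-from-coset-determined p q q' c∈ipT̃
              (rel-injective-modulo-T̃ p q q' (c , w , c∈ipT̃ , w∈iq'T̃ , cw≡)))
  ... | w' , cw'≡cw , w'iq≡wiq' =
    w' , trans cw'≡cw cw≡ , coset-sym (subst (_∈ T̃) (sym w'iq≡wiq') (coset-sym w∈iq'T̃))

  coset-lifting : CosetLifting
  coset-lifting {x} {y} z x∈yT̃ =
    m , xm≡yz ,
    coset-trans (coset-euclidean z∈iqT̃ w₂∈iqT̃)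
                (coset-sym (subst (_∈ T̃) (sym mw₂≡zw₁) (coset-euclidean z∈iqT̃ w₁∈iqT̃)))
    where
    p = proj₁ (representative y)
    y∈ipT̃ = proj₂ (representative y)
    q = proj₁ (representative z)
    z∈iqT̃ = proj₂ (representative z)
    w₁ = neighbour-in-coset p q y∈ipT̃
    w₂ = neighbour-in-coset p q (coset-trans y∈ipT̃ x∈yT̃)
    w₁∈iqT̃ = proj₂ (proj₂ w₁)
    w₂∈iqT̃ = proj₂ (proj₂ w₂)
    lifted-path = path-transport {y} {proj₁ w₁} {x} {proj₁ w₂} {z}
                    (trans (proj₁ (proj₂ w₁)) (sym (proj₁ (proj₂ w₂))))
    m = proj₁ lifted-path
    xm≡yz = proj₁ (proj₂ lifted-path)
    mw₂≡zw₁ = proj₂ (proj₂ lifted-path)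

lemma7p1 : (T U S : Scheme) (T̃ : Subset (Scheme.d S)) →
    Closed S T̃ →
    (Σ (Fin (Scheme.n T) → Str.Pt (subStr S T̃)) λ φ →
       IsIso (str T) (subStr S T̃) φ × (proj₁ (φ (Scheme.base T)) ≡ Scheme.base S)) →
    (i : Fin (Scheme.n U) → Fin (Scheme.n S)) →
    IsBasedMorphism U S i →
    IsIso (str U) (quotStr S T̃) i →
    (∀ u t → t ∈ T̃ → ProdSingleton S t (imgRel U S i u)) →
    Normal S T̃
lemma7p1 T U S T̃ closed (φ , _ , _) i based iso singleton =
  coset-lifting⇒normal
    (coset-lifting U S T̃ closed T̃-inhabited i (IsBasedMorphism.morph based) iso singleton)
  where
  T̃-inhabited = proj₂ (φ (Scheme.base T))
  open Cosets S T̃ closed T̃-inhabited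
  open CosetLiftingFromSection using (coset-lifting)
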